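{- Let $A$ be an $m\times n$ matrix over a commutative ring with unity, let $x$ be an indeterminate, and let $H\subseteq N_m$. Then \[ R(x;A)=\sum_{K\subseteq N_n,\ |K|\leqslant|H|}\operatorname{per}(A[H\mid K])\,x^{|K|}\,R\bigl(x;A[N_m\setminus H\mid N_n\setminus K]\bigr). \]
   Context: $N_m=\{1,\dots,m\}$. For $H\subseteq N_m$, $K\subseteq N_n$, $A[H\mid K]$ is the submatrix with rows $H$ and columns $K$. For a $p\times q$ matrix $B=(b_{i,j})$, the rook polynomial is $R(x;B)=\sum_{j\ge0}x^j\sum_{S\subseteq N_p,|S|=j}\sum_{\sigma:S\to N_q\text{ injective}}\prod_{i\in S}b_{i,\sigma(i)}$ (equal to $1$ for an empty matrix), and the permanent of $B$ is the sum over all injections of the smaller of the row/column index sets into the larger one of the product of the corresponding entries (for $p\le q$: $\sum_{\sigma:N_p\to N_q\text{ injective}}\prod_i b_{i,\sigma(i)}$; for $p>q$: $\sum_{\tau:N_q\to N_p\text{ injective}}\prod_j b_{\tau(j),j}$; equal to $1$ if $p=0$ or $q=0$). -}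

module Defs where

open import Level using (Level)
open import Data.Bool using (Bool; true; false)
open import Data.Nat using (ℕ; zero; suc; _∸_; _≤_; _≤?_)
import Data.Nat as ℕ
open import Data.Fin using (Fin; zero; suc; _≟_)
open import Data.Fin.Properties using (all?)
open import Data.Fin.Subset using (Subset; ∣_∣; ∁; inside; outside)
open import Data.Vec using (Vec; []; _∷_)
open import Data.List using (List; []; _∷_; [_]; map; concatMap; filter; allFin; upTo; foldr)
open import Function.Definitions using (Injective)
open import Relation.Binary.PropositionalEquality using (_≡_)
open import Relation.Nullary using (Dec; yes; no)
open import Relation.Nullary.Decidable using (_→-dec_)
open import Algebra.Bundles using (CommutativeRing)

allSubsets : (n : ℕ) → List (Subset n)
allSubsets zero = [ [] ]
allSubsets (suc n) =
  concatMap (λ S → (outside ∷ S) ∷ (inside ∷ S) ∷ []) (allSubsets n)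

enum : ∀ {n} (S : Subset n) → Fin ∣ S ∣ → Fin n
enum (true ∷ S) zero = zero
enum (true ∷ S) (suc i) = suc (enum S i)
enum (false ∷ S) i = suc (enum S i)

allFuns : (p q : ℕ) → List (Fin p → Fin q)
allFuns zero q = [ (λ ()) ]
allFuns (suc p) q =
  concatMap (λ f → map (λ y → λ { zero → y ; (suc i) → f i }) (allFin q)) (allFuns p q)

injective? : ∀ {p q} (σ : Fin p → Fin q) → Dec (Injective _≡_ _≡_ σ)
injective? σ with all? (λ i → all? (λ j → (σ i ≟ σ j) →-dec (i ≟ j)))
... | yes h = yes (λ {i} {j} → h i j)
... | no ¬h = no (λ inj → ¬h (λ i j → inj))

injections : (p q : ℕ) → List (Fin p → Fin q)
injections p q = filter injective? (allFuns p q)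

module Rook {c ℓ} (R : CommutativeRing c ℓ) where
  open CommutativeRing R using (Carrier; _≈_; _+_; _*_; 0#; 1#)

  Matrix : ℕ → ℕ → Set c
  Matrix p q = Fin p → Fin q → Carrier

  sub : ∀ {m n} → Matrix m n → (H : Subset m) (K : Subset n) → Matrix ∣ H ∣ ∣ K ∣
  sub A H K i j = A (enum H i) (enum K j)

  sumL : ∀ {a} {X : Set a} → List X → (X → Carrier) → Carrier
  sumL xs f = foldr (λ x r → f x + r) 0# xs

  prodF : ∀ {p} → (Fin p → Carrier) → Carrier
  prodF {zero} f = 1#
  prodF {suc p} f = f zero * prodF (λ i → f (suc i))

  per : ∀ {p q} → Matrix p q → Carrier
  per {p} {q} B with p ≤? q
  ... | yes _ = sumL (injections p q) (λ σ → prodF (λ i → B i (σ i)))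
  ... | no _ = sumL (injections q p) (λ τ → prodF (λ j → B (τ j) j))

  -- polynomials in x over R, as coefficient sequences (coefficient of x^j)
  Poly : Set c
  Poly = ℕ → Carrier

  _≈ₚ_ : Poly → Poly → Set ℓ
  P ≈ₚ Q = ∀ j → P j ≈ Q j

  _+ₚ_ : Poly → Poly → Poly
  (P +ₚ Q) j = P j + Q j

  _*ₚ_ : Poly → Poly → Poly
  (P *ₚ Q) j = sumL (upTo (suc j)) (λ i → P i * Q (j ∸ i))

  0ₚ : Poly
  0ₚ j = 0#

  constₚ : Carrier → Poly
  constₚ a zero = a
  constₚ a (suc j) = 0#

  X^ : ℕ → Poly
  X^ k j with j ℕ.≟ k
  ... | yes _ = 1#
  ... | no _ = 0#

  sumₚ : ∀ {a} {X : Set a} → List X → (X → Poly) → Poly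
  sumₚ xs f = foldr (λ x r → f x +ₚ r) 0ₚ xs

  -- rook polynomial R(x; B): coefficient of x^j is the sum over S ⊆ N_p with |S| = j
  -- and injections σ : S → N_q of ∏_{i ∈ S} b_{i,σ(i)}
  -- (S is identified with Fin ∣ S ∣ via its increasing enumeration)
  rook : ∀ {p q} → Matrix p q → Poly
  rook {p} {q} B j =
    sumL (filter (λ S → ∣ S ∣ ℕ.≟ j) (allSubsets p))
      (λ S → sumL (injections ∣ S ∣ q) (λ σ → prodF (λ i → B (enum S i) (σ i))))

module Submission where

open import Defs
open import Level using (Level)
open import Data.Nat using (ℕ; _≤?_)
open import Data.Fin.Subset using (Subset; ∣_∣; ∁)
open import Data.List using (filter)
open import Algebra.Bundles using (CommutativeRing)

-- Every quantity is unfolded one row at a time.  For a matrix W,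
-- a set of rows H and a set U of forbidden columns we introduce
--   * fullRooks W H U : the sum, over placements of non-attacking rooks with
--     exactly one rook in every row of H and none in a column of U, of the
--     product of the covered entries;
--   * coverings W H K : the same sum over placements inside the rows of H
--     (rows may stay empty) whose rooks occupy exactly the columns of K;
--   * rookPoly W H U  : the rook polynomial of the rows H with the columns U
--     forbidden.
-- The injection sums in the definitions of `per` and `rook` are shown to be
-- such row recursions (after re-indexing submatrices), so that
-- per (A[H|K]) = coverings A H K whenever ∣K∣ ≤ ∣H∣, and
-- R(x; A[R|C]) = rookPoly A R (∁ C).  The heart of the proof is the
-- expansion rookPoly W ⊤ U = Σ_{K ∩ U = ∅} coverings W H K · x^∣K∣ ·
-- rookPoly W (∁ H) (U ∪ K), proved by induction on the rows: a row outside H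
-- only contributes to the second factor, a row of H either stays empty or
-- adds one column to K.  Taking U = ∅ gives the theorem; the terms with
-- ∣K∣ > ∣H∣ vanish because there are no coverings.

open import Data.Bool using (Bool; true; false; not; _∧_; _∨_; if_then_else_)
open import Data.Bool.Properties using (∧-identityʳ; ∨-zeroʳ)
open import Data.Nat using (zero; suc; _∸_; _≤_; _<_)
import Data.Nat as ℕ
import Data.Nat.Properties as ℕ
open import Data.Fin using (Fin; zero; suc; toℕ)
open import Data.Fin.Properties using (_≟_; suc-injective)
open import Data.Fin.Subset using (⊥; ⊤; _∪_)
open import Data.Fin.Subset.Properties using (∣⊥∣≡0; ∪-identityˡ)
open import Data.Vec using ([]; _∷_; lookup; _[_]≔_)
open import Data.Vec.Properties using (lookup-zipWith; lookup-map; lookup-replicate; []≔-idempotent; []≔-lookup)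
open import Data.List using (List; []; _∷_; map; concatMap; allFin; upTo; _++_; tabulate; applyUpTo)
open import Data.Product using (∃; _,_)
open import Data.Empty using (⊥-elim)
open import Function using (_∘_)
open import Function.Definitions using (Injective)
open import Relation.Binary.PropositionalEquality as ≡ using (_≡_; cong; cong₂)
open import Relation.Nullary using (Dec; yes; no; does; ¬_)

-- Subsets of N_n are boolean vectors; inserting y into U is  U [ y ]≔ true.

disjoint : ∀ {n} → Subset n → Subset n → Bool
disjoint [] [] = true
disjoint (a ∷ K) (b ∷ U) = not (a ∧ b) ∧ disjoint K U

isEmpty : ∀ {n} → Subset n → Bool
isEmpty [] = true
isEmpty (b ∷ K) = not b ∧ isEmpty K

-- The columns of a matrix are restricted to C and U ⊆ C is forbidden in the
-- submatrix; `extend C U` is the corresponding set of forbidden columns of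
-- the full matrix: everything outside C together with the image of U.
extend : ∀ {q} (C : Subset q) → Subset ∣ C ∣ → Subset q
extend [] U = []
extend (true ∷ C) (u ∷ U) = u ∷ extend C U
extend (false ∷ C) U = true ∷ extend C U

∧-swap : ∀ a b c → a ∧ (b ∧ c) ≡ b ∧ (a ∧ c)
∧-swap true b c = ≡.refl
∧-swap false true c = ≡.refl
∧-swap false false c = ≡.refl

lookup-insert : ∀ {n} (U : Subset n) y z → lookup (U [ y ]≔ true) z ≡ does (z ≟ y) ∨ lookup U z
lookup-insert (x ∷ U) zero zero = ≡.refl
lookup-insert (x ∷ U) zero (suc z) = ≡.refl
lookup-insert (x ∷ U) (suc y) zero = ≡.refl
lookup-insert (x ∷ U) (suc y) (suc z) = lookup-insert U y z

remove-insert : ∀ {n} (K : Subset n) y → lookup K y ≡ false → (K [ y ]≔ true) [ y ]≔ false ≡ K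
remove-insert K y y∉K = ≡.trans ([]≔-idempotent K y)
  (≡.trans (cong (K [ y ]≔_) (≡.sym y∉K)) ([]≔-lookup K y))

∣insert∣ : ∀ {n} (K : Subset n) y → lookup K y ≡ false → ∣ K [ y ]≔ true ∣ ≡ suc ∣ K ∣
∣insert∣ (false ∷ K) zero y∉K = ≡.refl
∣insert∣ (true ∷ K) (suc y) y∉K = cong suc (∣insert∣ K y y∉K)
∣insert∣ (false ∷ K) (suc y) y∉K = ∣insert∣ K y y∉K

∣remove∣ : ∀ {n} (K : Subset n) y → lookup K y ≡ true → suc ∣ K [ y ]≔ false ∣ ≡ ∣ K ∣
∣remove∣ (true ∷ K) zero y∈K = ≡.refl
∣remove∣ (true ∷ K) (suc y) y∈K = cong suc (∣remove∣ K y y∈K)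
∣remove∣ (false ∷ K) (suc y) y∈K = ∣remove∣ K y y∈K

insert-∪ˡ : ∀ {n} (U K : Subset n) y → (U [ y ]≔ true) ∪ K ≡ (U ∪ K) [ y ]≔ true
insert-∪ˡ (a ∷ U) (b ∷ K) zero = ≡.refl
insert-∪ˡ (a ∷ U) (b ∷ K) (suc y) = cong ((a ∨ b) ∷_) (insert-∪ˡ U K y)

insert-∪ʳ : ∀ {n} (U K : Subset n) y → U ∪ (K [ y ]≔ true) ≡ (U ∪ K) [ y ]≔ true
insert-∪ʳ (a ∷ U) (b ∷ K) zero = cong (_∷ (U ∪ K)) (∨-zeroʳ a)
insert-∪ʳ (a ∷ U) (b ∷ K) (suc y) = cong ((a ∨ b) ∷_) (insert-∪ʳ U K y)

disjoint-insertˡ : ∀ {n} (K U : Subset n) y → disjoint (K [ y ]≔ true) U ≡ not (lookup U y) ∧ disjoint K U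
disjoint-insertˡ (b ∷ K) (true ∷ U) zero = ≡.refl
disjoint-insertˡ (true ∷ K) (false ∷ U) zero = ≡.refl
disjoint-insertˡ (false ∷ K) (false ∷ U) zero = ≡.refl
disjoint-insertˡ (b ∷ K) (a ∷ U) (suc y) rewrite disjoint-insertˡ K U y =
  ∧-swap (not (b ∧ a)) (not (lookup U y)) (disjoint K U)

disjoint-insertʳ : ∀ {n} (K U : Subset n) y → disjoint K (U [ y ]≔ true) ≡ not (lookup K y) ∧ disjoint K U
disjoint-insertʳ (true ∷ K) (a ∷ U) zero = ≡.refl
disjoint-insertʳ (false ∷ K) (true ∷ U) zero = ≡.refl
disjoint-insertʳ (false ∷ K) (false ∷ U) zero = ≡.refl
disjoint-insertʳ (b ∷ K) (a ∷ U) (suc y) rewrite disjoint-insertʳ K U y =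
  ∧-swap (not (b ∧ a)) (not (lookup K y)) (disjoint K U)

disjoint-⊥ʳ : ∀ {n} (K : Subset n) → disjoint K ⊥ ≡ true
disjoint-⊥ʳ [] = ≡.refl
disjoint-⊥ʳ (true ∷ K) = disjoint-⊥ʳ K
disjoint-⊥ʳ (false ∷ K) = disjoint-⊥ʳ K

disjoint-⊥ˡ : ∀ {n} (U : Subset n) → disjoint ⊥ U ≡ true
disjoint-⊥ˡ [] = ≡.refl
disjoint-⊥ˡ (x ∷ U) = disjoint-⊥ˡ U

extend-insert : ∀ {q} (C : Subset q) (U : Subset ∣ C ∣) c →
                extend C (U [ c ]≔ true) ≡ extend C U [ enum C c ]≔ true
extend-insert (true ∷ C) (u ∷ U) zero = ≡.refl
extend-insert (true ∷ C) (u ∷ U) (suc c) = cong (u ∷_) (extend-insert C U c)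
extend-insert (false ∷ C) U c = cong (true ∷_) (extend-insert C U c)

extend-⊥ : ∀ {q} (C : Subset q) → extend C ⊥ ≡ ∁ C
extend-⊥ [] = ≡.refl
extend-⊥ (true ∷ C) = cong (false ∷_) (extend-⊥ C)
extend-⊥ (false ∷ C) = cong (true ∷_) (extend-⊥ C)

∁-involutive : ∀ {q} (K : Subset q) → ∁ (∁ K) ≡ K
∁-involutive [] = ≡.refl
∁-involutive (true ∷ K) = cong (true ∷_) (∁-involutive K)
∁-involutive (false ∷ K) = cong (false ∷_) (∁-involutive K)

∁-remove : ∀ {q} (K : Subset q) y → ∁ K [ y ]≔ true ≡ ∁ (K [ y ]≔ false)
∁-remove (x ∷ K) zero = ≡.refl
∁-remove (x ∷ K) (suc y) = cong (not x ∷_) (∁-remove K y)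

isEmpty-∣∣≡0 : ∀ {q} (K : Subset q) → ∣ K ∣ ≡ 0 → isEmpty K ≡ true
isEmpty-∣∣≡0 [] _ = ≡.refl
isEmpty-∣∣≡0 (false ∷ K) ∣K∣≡0 = isEmpty-∣∣≡0 K ∣K∣≡0

isEmpty-∣∣≡suc : ∀ {q} (K : Subset q) n → ∣ K ∣ ≡ suc n → isEmpty K ≡ false
isEmpty-∣∣≡suc (true ∷ K) n _ = ≡.refl
isEmpty-∣∣≡suc (false ∷ K) n ∣K∣≡1+n = isEmpty-∣∣≡suc K n ∣K∣≡1+n

tail : ∀ {k q} → (Fin (suc k) → Fin q) → Fin k → Fin q
tail f = f ∘ suc

inImage : ∀ {k q} → Fin q → (Fin k → Fin q) → Bool
inImage {zero} y f = false
inImage {suc k} y f = does (f zero ≟ y) ∨ inImage y (tail f)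

isInjective : ∀ {k q} → (Fin k → Fin q) → Bool
isInjective {zero} f = true
isInjective {suc k} f = not (inImage (f zero) (tail f)) ∧ isInjective (tail f)

avoids : ∀ {k q} → (Fin k → Fin q) → Subset q → Bool
avoids {zero} f U = true
avoids {suc k} f U = not (lookup U (f zero)) ∧ avoids (tail f) U

avoids-insert : ∀ {k q} (f : Fin k → Fin q) U y →
                avoids f (U [ y ]≔ true) ≡ not (inImage y f) ∧ avoids f U
avoids-insert {zero} f U y = ≡.refl
avoids-insert {suc k} f U y rewrite lookup-insert U y (f zero) | avoids-insert (tail f) U y
  with does (f zero ≟ y)
... | true = ≡.refl
... | false = ∧-swap (not (lookup U (f zero))) (not (inImage y (tail f))) (avoids (tail f) U)

avoids-⊥ : ∀ {k q} (f : Fin k → Fin q) → avoids f ⊥ ≡ true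
avoids-⊥ {zero} f = ≡.refl
avoids-⊥ {suc k} f rewrite lookup-replicate (f zero) false = avoids-⊥ (tail f)

inImage-witness : ∀ {k q} y (f : Fin k → Fin q) → inImage y f ≡ true → ∃ λ i → f i ≡ y
inImage-witness {suc k} y f e with f zero ≟ y
... | yes f0≡y = zero , f0≡y
... | no _ with inImage-witness y (tail f) e
... | i , fi≡y = suc i , fi≡y

inImage-intro : ∀ {k q} (f : Fin k → Fin q) i → inImage (f i) f ≡ true
inImage-intro f zero with f zero ≟ f zero
... | yes _ = ≡.refl
... | no f0≢f0 = ⊥-elim (f0≢f0 ≡.refl)
inImage-intro f (suc i) with f zero ≟ f (suc i)
... | yes _ = ≡.refl
... | no _ = inImage-intro (tail f) i

head-fresh : ∀ {k q} (f : Fin (suc k) → Fin q) → isInjective f ≡ true → ∀ i → ¬ f (suc i) ≡ f zero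
head-fresh f inj i fi≡f0 with inImage (f zero) (tail f) in fresh
head-fresh f () i fi≡f0 | true
... | false with ≡.trans (≡.sym fresh) (≡.subst (λ y → inImage y (tail f) ≡ true) fi≡f0 (inImage-intro (tail f) i))
...   | ()

tail-injective : ∀ {k q} (f : Fin (suc k) → Fin q) → isInjective f ≡ true → isInjective (tail f) ≡ true
tail-injective f inj with not (inImage (f zero) (tail f))
tail-injective f () | false
... | true = inj

isInjective-sound : ∀ {k q} (f : Fin k → Fin q) → isInjective f ≡ true → Injective _≡_ _≡_ f
isInjective-sound {suc k} f inj {zero} {zero} _ = ≡.refl
isInjective-sound {suc k} f inj {zero} {suc j} f0≡fj = ⊥-elim (head-fresh f inj j (≡.sym f0≡fj))
isInjective-sound {suc k} f inj {suc i} {zero} fi≡f0 = ⊥-elim (head-fresh f inj i fi≡f0)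
isInjective-sound {suc k} f inj {suc i} {suc j} fi≡fj =
  cong suc (isInjective-sound (tail f) (tail-injective f inj) fi≡fj)

isInjective-complete : ∀ {k q} (f : Fin k → Fin q) → Injective _≡_ _≡_ f → isInjective f ≡ true
isInjective-complete {zero} f inj = ≡.refl
isInjective-complete {suc k} f inj with inImage (f zero) (tail f) in headRepeated
... | true with inImage-witness (f zero) (tail f) headRepeated
...   | i , fi≡f0 with inj fi≡f0
...     | ()
isInjective-complete {suc k} f inj | false = isInjective-complete (tail f) (λ e → suc-injective (inj e))

does-injective? : ∀ {k q} (f : Fin k → Fin q) → does (injective? f) ≡ isInjective f
does-injective? f with injective? f
... | yes inj = ≡.sym (isInjective-complete f inj)
... | no ¬inj with isInjective f in e
...   | true = ⊥-elim (¬inj (isInjective-sound f e))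
...   | false = ≡.refl

module Expansion {c ℓ} (R : CommutativeRing c ℓ) where
  open CommutativeRing R
    using ( Carrier; _≈_; _+_; _*_; 0#; 1#; setoid; refl; sym; trans
          ; +-cong; +-congˡ; +-congʳ; *-cong; *-congˡ; *-congʳ; +-assoc; +-comm; *-assoc
          ; distribˡ; distribʳ; zeroˡ; zeroʳ; +-identityˡ; +-identityʳ; *-identityˡ
          ; +-commutativeSemigroup; *-commutativeSemigroup )
  open import Algebra.Properties.CommutativeSemigroup +-commutativeSemigroup
    using (interchange) renaming (x∙yz≈y∙xz to +-swapˡ)
  open import Algebra.Properties.CommutativeSemigroup *-commutativeSemigroup
    using () renaming (x∙yz≈y∙xz to *-swapˡ)
  open import Relation.Binary.Reasoning.Setoid setoid
  open Rook R

  ≡⇒≈ : ∀ {x y} → x ≡ y → x ≈ y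
  ≡⇒≈ ≡.refl = refl

  [_]⇒_ : Bool → Carrier → Carrier
  [ b ]⇒ x = if b then x else 0#

  []⇒-cong : ∀ b {x y} → x ≈ y → [ b ]⇒ x ≈ [ b ]⇒ y
  []⇒-cong true x≈y = x≈y
  []⇒-cong false x≈y = refl

  []⇒-0 : ∀ b → [ b ]⇒ 0# ≈ 0#
  []⇒-0 true = refl
  []⇒-0 false = refl

  []⇒-+ : ∀ b x y → [ b ]⇒ (x + y) ≈ [ b ]⇒ x + [ b ]⇒ y
  []⇒-+ true x y = refl
  []⇒-+ false x y = sym (+-identityʳ 0#)

  []⇒-*ˡ : ∀ b a x → a * [ b ]⇒ x ≈ [ b ]⇒ (a * x)
  []⇒-*ˡ true a x = refl
  []⇒-*ˡ false a x = zeroʳ a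

  []⇒-swap : ∀ a b x y z → [ a ]⇒ (x * [ b ]⇒ (y * z)) ≈ [ b ]⇒ (y * [ a ]⇒ (x * z))
  []⇒-swap true true x y z = *-swapˡ x y z
  []⇒-swap true false x y z = zeroʳ x
  []⇒-swap false true x y z = sym (zeroʳ y)
  []⇒-swap false false x y z = refl

  [_]⇒-dec : ∀ {p} {P : Set p} (P? : Dec P) {x y} → (P → x ≈ y) → (¬ P → 0# ≈ y) → [ does P? ]⇒ x ≈ y
  [ yes p ]⇒-dec onYes onNo = onYes p
  [ no ¬p ]⇒-dec onYes onNo = onNo ¬p

  sumFin : ∀ {n} → (Fin n → Carrier) → Carrier
  sumFin {zero} f = 0#
  sumFin {suc n} f = f zero + sumFin (f ∘ suc)

  sumFin-cong : ∀ {n} {f g : Fin n → Carrier} → (∀ i → f i ≈ g i) → sumFin f ≈ sumFin g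
  sumFin-cong {zero} f≈g = refl
  sumFin-cong {suc n} f≈g = +-cong (f≈g zero) (sumFin-cong (f≈g ∘ suc))

  sumFin-0 : ∀ {n} (f : Fin n → Carrier) → (∀ i → f i ≈ 0#) → sumFin f ≈ 0#
  sumFin-0 {zero} f f≈0 = refl
  sumFin-0 {suc n} f f≈0 = trans (+-cong (f≈0 zero) (sumFin-0 (f ∘ suc) (f≈0 ∘ suc))) (+-identityʳ 0#)

  sumFin-+ : ∀ {n} (f g : Fin n → Carrier) → sumFin (λ i → f i + g i) ≈ sumFin f + sumFin g
  sumFin-+ {zero} f g = sym (+-identityʳ 0#)
  sumFin-+ {suc n} f g = trans (+-congˡ (sumFin-+ (f ∘ suc) (g ∘ suc))) (interchange _ _ _ _)

  sumFin-*ˡ : ∀ {n} a (f : Fin n → Carrier) → a * sumFin f ≈ sumFin (λ i → a * f i)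
  sumFin-*ˡ {zero} a f = zeroʳ a
  sumFin-*ˡ {suc n} a f = trans (distribˡ a _ _) (+-congˡ (sumFin-*ˡ a (f ∘ suc)))

  sumFin-*ʳ : ∀ {n} (f : Fin n → Carrier) a → sumFin f * a ≈ sumFin (λ i → f i * a)
  sumFin-*ʳ {zero} f a = zeroˡ a
  sumFin-*ʳ {suc n} f a = trans (distribʳ a _ _) (+-congˡ (sumFin-*ʳ (f ∘ suc) a))

  []⇒-sumFin : ∀ {n} b (f : Fin n → Carrier) → [ b ]⇒ sumFin f ≈ sumFin (λ i → [ b ]⇒ f i)
  []⇒-sumFin true f = refl
  []⇒-sumFin {n} false f = sym (sumFin-0 {n} _ (λ i → refl))

  sumFin-swap : ∀ {m n} (f : Fin m → Fin n → Carrier) →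
                sumFin (λ i → sumFin (f i)) ≈ sumFin (λ j → sumFin (λ i → f i j))
  sumFin-swap {zero} {n} f = sym (sumFin-0 {n} _ (λ j → refl))
  sumFin-swap {suc m} f = trans (+-congˡ (sumFin-swap (f ∘ suc))) (sym (sumFin-+ (f zero) _))

  sumSub : ∀ n → (Subset n → Carrier) → Carrier
  sumSub zero g = g []
  sumSub (suc n) g = sumSub n (λ S → g (false ∷ S)) + sumSub n (λ S → g (true ∷ S))

  sumSub-cong : ∀ n {f g : Subset n → Carrier} → (∀ S → f S ≈ g S) → sumSub n f ≈ sumSub n g
  sumSub-cong zero f≈g = f≈g []
  sumSub-cong (suc n) f≈g = +-cong (sumSub-cong n (f≈g ∘ (false ∷_))) (sumSub-cong n (f≈g ∘ (true ∷_)))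

  sumSub-0 : ∀ n (f : Subset n → Carrier) → (∀ S → f S ≈ 0#) → sumSub n f ≈ 0#
  sumSub-0 zero f f≈0 = f≈0 []
  sumSub-0 (suc n) f f≈0 =
    trans (+-cong (sumSub-0 n _ (f≈0 ∘ (false ∷_))) (sumSub-0 n _ (f≈0 ∘ (true ∷_)))) (+-identityʳ 0#)

  sumSub-+ : ∀ n (f g : Subset n → Carrier) → sumSub n (λ S → f S + g S) ≈ sumSub n f + sumSub n g
  sumSub-+ zero f g = refl
  sumSub-+ (suc n) f g = trans (+-cong (sumSub-+ n _ _) (sumSub-+ n _ _)) (interchange _ _ _ _)

  sumSub-*ˡ : ∀ n a (f : Subset n → Carrier) → a * sumSub n f ≈ sumSub n (λ S → a * f S)
  sumSub-*ˡ zero a f = refl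
  sumSub-*ˡ (suc n) a f = trans (distribˡ a _ _) (+-cong (sumSub-*ˡ n a _) (sumSub-*ˡ n a _))

  sumFin-sumSub-swap : ∀ {m} n (f : Fin m → Subset n → Carrier) →
                       sumFin (λ i → sumSub n (f i)) ≈ sumSub n (λ S → sumFin (λ i → f i S))
  sumFin-sumSub-swap {zero} n f = sym (sumSub-0 n _ (λ S → refl))
  sumFin-sumSub-swap {suc m} n f = trans (+-congˡ (sumFin-sumSub-swap n (f ∘ suc))) (sym (sumSub-+ n _ _))

  sumSub-isEmpty : ∀ n (f : Subset n → Carrier) → sumSub n (λ K → [ isEmpty K ]⇒ f K) ≈ f ⊥
  sumSub-isEmpty zero f = refl
  sumSub-isEmpty (suc n) f =
    trans (+-cong (sumSub-isEmpty n (f ∘ (false ∷_))) (sumSub-0 n _ (λ S → refl))) (+-identityʳ _)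

  -- Reindexing by K ↦ K ∪ {y}: the sets containing y are the sets K ∌ y
  -- with y added.
  sumSub-member : ∀ n y (F : Subset n → Carrier) →
    sumSub n (λ K → [ lookup K y ]⇒ F K) ≈ sumSub n (λ K → [ not (lookup K y) ]⇒ F (K [ y ]≔ true))
  sumSub-member (suc n) zero F = +-comm _ _
  sumSub-member (suc n) (suc y) F = +-cong (sumSub-member n y (F ∘ (false ∷_))) (sumSub-member n y (F ∘ (true ∷_)))

  sumL-cong : ∀ {a} {X : Set a} (xs : List X) {f g : X → Carrier} → (∀ x → f x ≈ g x) → sumL xs f ≈ sumL xs g
  sumL-cong [] f≈g = refl
  sumL-cong (x ∷ xs) f≈g = +-cong (f≈g x) (sumL-cong xs f≈g)

  sumL-0 : ∀ {a} {X : Set a} (xs : List X) (f : X → Carrier) → (∀ x → f x ≈ 0#) → sumL xs f ≈ 0#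
  sumL-0 [] f f≈0 = refl
  sumL-0 (x ∷ xs) f f≈0 = trans (+-cong (f≈0 x) (sumL-0 xs f f≈0)) (+-identityʳ 0#)

  sumL-*ˡ : ∀ {a} {X : Set a} (xs : List X) w (f : X → Carrier) → w * sumL xs f ≈ sumL xs (λ x → w * f x)
  sumL-*ˡ [] w f = zeroʳ w
  sumL-*ˡ (x ∷ xs) w f = trans (distribˡ w _ _) (+-congˡ (sumL-*ˡ xs w f))

  sumL-++ : ∀ {a} {X : Set a} (xs ys : List X) (f : X → Carrier) → sumL (xs ++ ys) f ≈ sumL xs f + sumL ys f
  sumL-++ [] ys f = sym (+-identityˡ _)
  sumL-++ (x ∷ xs) ys f = trans (+-congˡ (sumL-++ xs ys f)) (sym (+-assoc _ _ _))

  sumL-map : ∀ {a b} {X : Set a} {Y : Set b} (h : X → Y) (xs : List X) (f : Y → Carrier) →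
             sumL (map h xs) f ≈ sumL xs (f ∘ h)
  sumL-map h [] f = refl
  sumL-map h (x ∷ xs) f = +-congˡ (sumL-map h xs f)

  sumL-concatMap : ∀ {a b} {X : Set a} {Y : Set b} (h : X → List Y) (xs : List X) (f : Y → Carrier) →
                   sumL (concatMap h xs) f ≈ sumL xs (λ x → sumL (h x) f)
  sumL-concatMap h [] f = refl
  sumL-concatMap h (x ∷ xs) f = trans (sumL-++ (h x) _ f) (+-congˡ (sumL-concatMap h xs f))

  sumL-filter : ∀ {a p} {X : Set a} {P : X → Set p} (P? : ∀ x → Dec (P x)) (xs : List X) (f : X → Carrier) →
                sumL (filter P? xs) f ≈ sumL xs (λ x → [ does (P? x) ]⇒ f x)
  sumL-filter P? [] f = refl
  sumL-filter P? (x ∷ xs) f with does (P? x)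
  ... | true = +-congˡ (sumL-filter P? xs f)
  ... | false = trans (sumL-filter P? xs f) (sym (+-identityˡ _))

  sumL-sumFin-swap : ∀ {a} {X : Set a} {n} (xs : List X) (h : X → Fin n → Carrier) →
                     sumL xs (λ x → sumFin (h x)) ≈ sumFin (λ y → sumL xs (λ x → h x y))
  sumL-sumFin-swap {n = n} [] h = sym (sumFin-0 {n} _ (λ y → refl))
  sumL-sumFin-swap (x ∷ xs) h = trans (+-congˡ (sumL-sumFin-swap xs h)) (sym (sumFin-+ (h x) _))

  sumL-allFin : ∀ {n} (h : Fin n → Carrier) → sumL (allFin n) h ≈ sumFin h
  sumL-allFin h = tabulated _ (λ i → i) h
    where
    tabulated : ∀ n {A : Set} (t : Fin n → A) (h : A → Carrier) → sumL (tabulate t) h ≈ sumFin (h ∘ t)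
    tabulated zero t h = refl
    tabulated (suc n) t h = +-congˡ (tabulated n (t ∘ suc) h)

  sumL-applyUpTo : ∀ n (f : ℕ → ℕ) (h : ℕ → Carrier) → sumL (applyUpTo f n) h ≈ sumFin {n} (λ i → h (f (toℕ i)))
  sumL-applyUpTo zero f h = refl
  sumL-applyUpTo (suc n) f h = +-congˡ (sumL-applyUpTo n (f ∘ suc) h)

  sumL-allSubsets : ∀ n (f : Subset n → Carrier) → sumL (allSubsets n) f ≈ sumSub n f
  sumL-allSubsets zero f = +-identityʳ _
  sumL-allSubsets (suc n) f = begin
    sumL (concatMap (λ S → (false ∷ S) ∷ (true ∷ S) ∷ []) (allSubsets n)) f
      ≈⟨ sumL-concatMap _ (allSubsets n) f ⟩
    sumL (allSubsets n) (λ S → f (false ∷ S) + (f (true ∷ S) + 0#))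
      ≈⟨ sumL-allSubsets n _ ⟩
    sumSub n (λ S → f (false ∷ S) + (f (true ∷ S) + 0#))
      ≈⟨ sumSub-cong n (λ S → +-congˡ (+-identityʳ _)) ⟩
    sumSub n (λ S → f (false ∷ S) + f (true ∷ S))
      ≈⟨ sumSub-+ n _ _ ⟩
    sumSub (suc n) f ∎

  []⇒-distrib : ∀ b w x y → [ b ]⇒ (w * (x + y)) ≈ [ b ]⇒ (w * x) + [ b ]⇒ (w * y)
  []⇒-distrib b w x y = trans ([]⇒-cong b (distribˡ w x y)) ([]⇒-+ b _ _)

  []⇒-sumFin-*ˡ : ∀ {n} b w (f : Fin n → Carrier) → [ b ]⇒ (w * sumFin f) ≈ sumFin (λ i → [ b ]⇒ (w * f i))
  []⇒-sumFin-*ˡ b w f = trans ([]⇒-cong b (sumFin-*ˡ w f)) ([]⇒-sumFin b (λ i → w * f i))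

  []⇒-sumFin-*ʳ : ∀ {n} b (f : Fin n → Carrier) s → [ b ]⇒ (sumFin f * s) ≈ sumFin (λ i → [ b ]⇒ (f i * s))
  []⇒-sumFin-*ʳ b f s = trans ([]⇒-cong b (sumFin-*ʳ f s)) ([]⇒-sumFin b (λ i → f i * s))

  []⇒-sumSub-*ˡ : ∀ n b w (f : Subset n → Carrier) → [ b ]⇒ (w * sumSub n f) ≈ sumSub n (λ S → [ b ]⇒ (w * f S))
  []⇒-sumSub-*ˡ n true w f = sumSub-*ˡ n w f
  []⇒-sumSub-*ˡ n false w f = sym (sumSub-0 n _ (λ S → refl))

  []⇒-sumL-*ˡ : ∀ {a} {X : Set a} (xs : List X) b w (f : X → Carrier) → [ b ]⇒ (w * sumL xs f) ≈ sumL xs (λ x → [ b ]⇒ (w * f x))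
  []⇒-sumL-*ˡ xs true w f = sumL-*ˡ xs w f
  []⇒-sumL-*ˡ xs false w f = sym (sumL-0 xs _ (λ x → refl))

  -- Polynomials: shift k P is x^k · P.
  shift : ℕ → Poly → Poly
  shift zero P j = P j
  shift (suc k) P zero = 0#
  shift (suc k) P (suc j) = shift k P j

  shift-cong : ∀ k {P Q : Poly} → P ≈ₚ Q → shift k P ≈ₚ shift k Q
  shift-cong zero P≈Q j = P≈Q j
  shift-cong (suc k) P≈Q zero = refl
  shift-cong (suc k) P≈Q (suc j) = shift-cong k P≈Q j

  shift-+ : ∀ k (P Q : Poly) j → shift k (P +ₚ Q) j ≈ shift k P j + shift k Q j
  shift-+ zero P Q j = refl
  shift-+ (suc k) P Q zero = sym (+-identityʳ 0#)
  shift-+ (suc k) P Q (suc j) = shift-+ k P Q j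

  shift-[]⇒ : ∀ k b w (P : Poly) j → shift k (λ i → [ b ]⇒ (w * P i)) j ≈ [ b ]⇒ (w * shift k P j)
  shift-[]⇒ zero b w P j = refl
  shift-[]⇒ (suc k) b w P zero = sym (trans ([]⇒-cong b (zeroʳ w)) ([]⇒-0 b))
  shift-[]⇒ (suc k) b w P (suc j) = shift-[]⇒ k b w P j

  shift-sumFin : ∀ k {n} (f : Fin n → Poly) j → shift k (λ i → sumFin (λ y → f y i)) j ≈ sumFin (λ y → shift k (f y) j)
  shift-sumFin zero f j = refl
  shift-sumFin (suc k) {n} f zero = sym (sumFin-0 {n} _ (λ y → refl))
  shift-sumFin (suc k) f (suc j) = shift-sumFin k f j

  shift-sumSub : ∀ k n (f : Subset n → Poly) j → shift k (λ i → sumSub n (λ S → f S i)) j ≈ sumSub n (λ S → shift k (f S) j)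
  shift-sumSub zero n f j = refl
  shift-sumSub (suc k) n f zero = sym (sumSub-0 n _ (λ S → refl))
  shift-sumSub (suc k) n f (suc j) = shift-sumSub k n f j

  shift-suc : ∀ k (P : Poly) j → shift 1 (shift k P) j ≡ shift (suc k) P j
  shift-suc k P zero = ≡.refl
  shift-suc k P (suc j) = ≡.refl

  shift-comm : ∀ k (P : Poly) j → shift k (shift 1 P) j ≡ shift 1 (shift k P) j
  shift-comm zero P j = ≡.refl
  shift-comm (suc k) P zero = ≡.refl
  shift-comm (suc k) P (suc j) = ≡.trans (shift-comm k P j) (shift-suc k P j)

  X^-suc : ∀ k i → X^ (suc k) (suc i) ≈ X^ k i
  X^-suc k i with suc i ℕ.≟ suc k | i ℕ.≟ k
  ... | yes _ | yes _ = refl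
  ... | no _ | no _ = refl
  ... | yes 1+i≡1+k | no i≢k = ⊥-elim (i≢k (ℕ.suc-injective 1+i≡1+k))
  ... | no 1+i≢1+k | yes i≡k = ⊥-elim (1+i≢1+k (cong suc i≡k))

  constₚ-* : ∀ a (Q : Poly) i → (constₚ a *ₚ Q) i ≈ a * Q i
  constₚ-* a Q i = trans (sumL-applyUpTo (suc i) (λ t → t) (λ t → constₚ a t * Q (i ∸ t)))
    (trans (+-congˡ (sumFin-0 {i} _ (λ t → zeroˡ _))) (+-identityʳ _))

  X^-convolution : ∀ j k (P : Poly) → sumFin {suc j} (λ t → X^ k (toℕ t) * P (j ∸ toℕ t)) ≈ shift k P j
  X^-convolution zero zero P = trans (+-identityʳ _) (*-identityˡ _)
  X^-convolution zero (suc k) P = trans (+-identityʳ _) (zeroˡ _)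
  X^-convolution (suc j) zero P =
    trans (+-cong (*-identityˡ _) (sumFin-0 {suc j} (λ t → X^ 0 (suc (toℕ t)) * P (j ∸ toℕ t)) (λ t → zeroˡ _)))
          (+-identityʳ _)
  X^-convolution (suc j) (suc k) P = trans (+-congʳ (zeroˡ _)) (trans (+-identityˡ _)
    (trans (sumFin-cong {suc j} {λ t → X^ (suc k) (suc (toℕ t)) * P (j ∸ toℕ t)} (λ t → *-congʳ (X^-suc k (toℕ t))))
           (X^-convolution j k P)))

  monomial-* : ∀ a k (P : Poly) j → ((constₚ a *ₚ X^ k) *ₚ P) j ≈ a * shift k P j
  monomial-* a k P j = begin
    sumL (upTo (suc j)) (λ i → (constₚ a *ₚ X^ k) i * P (j ∸ i))
      ≈⟨ sumL-cong (upTo (suc j)) (λ i → trans (*-congʳ (constₚ-* a (X^ k) i)) (*-assoc a _ _)) ⟩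
    sumL (upTo (suc j)) (λ i → a * (X^ k i * P (j ∸ i)))
      ≈⟨ sym (sumL-*ˡ (upTo (suc j)) a _) ⟩
    a * sumL (upTo (suc j)) (λ i → X^ k i * P (j ∸ i))
      ≈⟨ *-congˡ (sumL-applyUpTo (suc j) (λ t → t) (λ i → X^ k i * P (j ∸ i))) ⟩
    a * sumFin {suc j} (λ t → X^ k (toℕ t) * P (j ∸ toℕ t))
      ≈⟨ *-congˡ (X^-convolution j k P) ⟩
    a * shift k P j ∎

  sumₚ-coefficient : ∀ {a} {X : Set a} (xs : List X) (f : X → Poly) j → sumₚ xs f j ≈ sumL xs (λ x → f x j)
  sumₚ-coefficient [] f j = refl
  sumₚ-coefficient (x ∷ xs) f j = +-congˡ (sumₚ-coefficient xs f j)

  dropRow : ∀ {p q} → Matrix (suc p) q → Matrix p q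
  dropRow W i y = W (suc i) y

  dropCol : ∀ {p q} → Matrix p (suc q) → Matrix p q
  dropCol W i y = W i (suc y)

  transpose : ∀ {p q} → Matrix p q → Matrix q p
  transpose W y i = W i y

  -- fullRooks W H U: the sum, over all ways of putting one non-attacking rook
  -- in every row of H and no rook in a column of U, of the product of the
  -- covered entries.
  fullRooks : ∀ {p q} → Matrix p q → Subset p → Subset q → Carrier
  fullRooks {zero} W [] U = 1#
  fullRooks {suc p} W (false ∷ H) U = fullRooks (dropRow W) H U
  fullRooks {suc p} W (true ∷ H) U =
    sumFin (λ y → [ not (lookup U y) ]⇒ (W zero y * fullRooks (dropRow W) H (U [ y ]≔ true)))

  -- The injection sum used by `per` and `rook` is fullRooks on all rows:
  -- choosing σ 0 = y and an injective tail avoiding U ∪ {y} is one step of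
  -- the row recursion.
  injectionSum-avoiding : ∀ k {q} (V : Matrix k q) U →
    sumL (allFuns k q) (λ f → [ isInjective f ∧ avoids f U ]⇒ prodF (λ i → V i (f i))) ≈ fullRooks V ⊤ U
  injectionSum-avoiding zero V U = +-identityʳ 1#
  injectionSum-avoiding (suc k) {q} V U = begin
    sumL (allFuns (suc k) q) term
      ≈⟨ sumL-concatMap _ (allFuns k q) term ⟩
    sumL (allFuns k q) (λ f → sumL (map _ (allFin q)) term)
      ≈⟨ sumL-cong (allFuns k q) (λ f → trans (sumL-map _ (allFin q) term) (sumL-allFin (extended f))) ⟩
    sumL (allFuns k q) (λ f → sumFin (extended f))
      ≈⟨ sumL-cong (allFuns k q) (λ f → sumFin-cong (regroup f)) ⟩
    sumL (allFuns k q) (λ f → sumFin (grouped f))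
      ≈⟨ sumL-sumFin-swap (allFuns k q) grouped ⟩
    sumFin (λ y → sumL (allFuns k q) (λ f → grouped f y))
      ≈⟨ sumFin-cong (λ y → sym ([]⇒-sumL-*ˡ (allFuns k q) (not (lookup U y)) (V zero y) _)) ⟩
    sumFin (λ y → [ not (lookup U y) ]⇒ (V zero y * sumL (allFuns k q) (λ f →
      [ isInjective f ∧ avoids f (U [ y ]≔ true) ]⇒ prodF (λ i → V (suc i) (f i)))))
      ≈⟨ sumFin-cong (λ y → []⇒-cong (not (lookup U y)) (*-congˡ (injectionSum-avoiding k (dropRow V) (U [ y ]≔ true)))) ⟩
    fullRooks V ⊤ U ∎
    where
    term : (Fin (suc k) → Fin q) → Carrier
    term f = [ isInjective f ∧ avoids f U ]⇒ prodF (λ i → V i (f i))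
    -- the summand for the function sending 0 to y and suc i to f i
    extended : (Fin k → Fin q) → Fin q → Carrier
    extended f y = [ (not (inImage y f) ∧ isInjective f) ∧ (not (lookup U y) ∧ avoids f U) ]⇒
                     (V zero y * prodF (λ i → V (suc i) (f i)))
    grouped : (Fin k → Fin q) → Fin q → Carrier
    grouped f y = [ not (lookup U y) ]⇒ (V zero y * [ isInjective f ∧ avoids f (U [ y ]≔ true) ]⇒ prodF (λ i → V (suc i) (f i)))
    brackets : ∀ a b c d x y → [ (a ∧ b) ∧ (c ∧ d) ]⇒ (x * y) ≈ [ c ]⇒ (x * [ b ∧ (a ∧ d) ]⇒ y)
    brackets true true true d x y = sym ([]⇒-*ˡ d x y)
    brackets true true false d x y = refl
    brackets true false true d x y = sym (zeroʳ x)
    brackets true false false d x y = refl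
    brackets false true true d x y = sym (zeroʳ x)
    brackets false true false d x y = refl
    brackets false false true d x y = sym (zeroʳ x)
    brackets false false false d x y = refl
    regroup : ∀ f y → extended f y ≈ grouped f y
    regroup f y rewrite avoids-insert f U y =
      brackets (not (inImage y f)) (isInjective f) (not (lookup U y)) (avoids f U) _ _

  injectionSum-fullRooks : ∀ k {q} (V : Matrix k q) → sumL (injections k q) (λ σ → prodF (λ i → V i (σ i))) ≈ fullRooks V ⊤ ⊥
  injectionSum-fullRooks k {q} V = begin
    sumL (injections k q) (λ σ → prodF (λ i → V i (σ i)))
      ≈⟨ sumL-filter injective? (allFuns k q) _ ⟩
    sumL (allFuns k q) (λ f → [ does (injective? f) ]⇒ prodF (λ i → V i (f i)))
      ≈⟨ sumL-cong (allFuns k q) (λ f → ≡⇒≈ (cong ([_]⇒ prodF (λ i → V i (f i))) (test f))) ⟩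
    sumL (allFuns k q) (λ f → [ isInjective f ∧ avoids f ⊥ ]⇒ prodF (λ i → V i (f i)))
      ≈⟨ injectionSum-avoiding k V ⊥ ⟩
    fullRooks V ⊤ ⊥ ∎
    where
    test : ∀ f → does (injective? f) ≡ isInjective f ∧ avoids f ⊥
    test f = ≡.trans (does-injective? f) (≡.sym (≡.trans (cong (isInjective f ∧_) (avoids-⊥ f)) (∧-identityʳ _)))

  fullRooks-rows : ∀ {p q} (W : Matrix p q) H U → fullRooks (λ i → W (enum H i)) ⊤ U ≈ fullRooks W H U
  fullRooks-rows {zero} W [] U = refl
  fullRooks-rows {suc p} W (false ∷ H) U = fullRooks-rows (dropRow W) H U
  fullRooks-rows {suc p} W (true ∷ H) U =
    sumFin-cong (λ y → []⇒-cong (not (lookup U y)) (*-congˡ (fullRooks-rows (dropRow W) H (U [ y ]≔ true))))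

  sumFin-columns : ∀ {q} (C : Subset q) (U : Subset ∣ C ∣) (g : Fin q → Carrier) →
    sumFin (λ c → [ not (lookup U c) ]⇒ g (enum C c)) ≈ sumFin (λ y → [ not (lookup (extend C U) y) ]⇒ g y)
  sumFin-columns [] [] g = refl
  sumFin-columns (false ∷ C) U g = trans (sumFin-columns C U (g ∘ suc)) (sym (+-identityˡ _))
  sumFin-columns (true ∷ C) (u ∷ U) g = +-congˡ (sumFin-columns C U (g ∘ suc))

  fullRooks-columns : ∀ {p q} (C : Subset q) (V : Matrix p q) H (U : Subset ∣ C ∣) →
                      fullRooks (λ i c → V i (enum C c)) H U ≈ fullRooks V H (extend C U)
  fullRooks-columns {zero} C V [] U = refl
  fullRooks-columns {suc p} C V (false ∷ H) U = fullRooks-columns C (dropRow V) H U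
  fullRooks-columns {suc p} C V (true ∷ H) U = trans
    (sumFin-cong (λ c → []⇒-cong (not (lookup U c)) (*-congˡ (trans (fullRooks-columns C (dropRow V) H (U [ c ]≔ true))
       (≡⇒≈ (cong (fullRooks (dropRow V) H) (extend-insert C U c)))))))
    (sumFin-columns C U (λ y → V zero y * fullRooks (dropRow V) H (extend C U [ y ]≔ true)))

  injectionSum-sub : ∀ {m n} (A : Matrix m n) H K →
    sumL (injections ∣ H ∣ ∣ K ∣) (λ σ → prodF (λ i → sub A H K i (σ i))) ≈ fullRooks A H (∁ K)
  injectionSum-sub A H K = begin
    sumL (injections ∣ H ∣ ∣ K ∣) (λ σ → prodF (λ i → sub A H K i (σ i)))
      ≈⟨ injectionSum-fullRooks ∣ H ∣ (sub A H K) ⟩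
    fullRooks (sub A H K) ⊤ ⊥
      ≈⟨ fullRooks-columns K (λ i → A (enum H i)) ⊤ ⊥ ⟩
    fullRooks (λ i → A (enum H i)) ⊤ (extend K ⊥)
      ≈⟨ fullRooks-rows A H (extend K ⊥) ⟩
    fullRooks A H (extend K ⊥)
      ≈⟨ ≡⇒≈ (cong (fullRooks A H) (extend-⊥ K)) ⟩
    fullRooks A H (∁ K) ∎

  -- coverings W H K: the sum over placements of non-attacking rooks in the
  -- rows of H (a row may stay empty) whose rooks occupy exactly the columns
  -- of K.
  coverings : ∀ {p q} → Matrix p q → Subset p → Subset q → Carrier
  coverings {zero} W [] K = [ isEmpty K ]⇒ 1#
  coverings {suc p} W (false ∷ H) K = coverings (dropRow W) H K
  coverings {suc p} W (true ∷ H) K =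
    coverings (dropRow W) H K + sumFin (λ y → [ lookup K y ]⇒ (W zero y * coverings (dropRow W) H (K [ y ]≔ false)))

  -- Rooks placed column by column, one in each column of K.  A forbidden
  -- first row is simply dropped; a free first row is used by at most one
  -- column y of K.
  fullRooksᵀ-forbiddenRow : ∀ {p q} (W : Matrix (suc p) q) K U →
    fullRooks (transpose W) K (true ∷ U) ≈ fullRooks (transpose (dropRow W)) K U
  fullRooksᵀ-forbiddenRow {p} {zero} W [] U = refl
  fullRooksᵀ-forbiddenRow {p} {suc q} W (false ∷ K) U = fullRooksᵀ-forbiddenRow (dropCol W) K U
  fullRooksᵀ-forbiddenRow {p} {suc q} W (true ∷ K) U = trans (+-identityˡ _)
    (sumFin-cong (λ r → []⇒-cong (not (lookup U r)) (*-congˡ (fullRooksᵀ-forbiddenRow (dropCol W) K (U [ r ]≔ true)))))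

  fullRooksᵀ-freeRow : ∀ {p q} (W : Matrix (suc p) q) K U →
    fullRooks (transpose W) K (false ∷ U)
      ≈ fullRooks (transpose (dropRow W)) K U
        + sumFin (λ y → [ lookup K y ]⇒ (W zero y * fullRooks (transpose (dropRow W)) (K [ y ]≔ false) U))
  fullRooksᵀ-freeRow {p} {zero} W [] U = sym (+-identityʳ 1#)
  fullRooksᵀ-freeRow {p} {suc q} W (false ∷ K) U =
    trans (fullRooksᵀ-freeRow (dropCol W) K U) (+-congˡ (sym (+-identityˡ _)))
  fullRooksᵀ-freeRow {p} {suc q} W (true ∷ K) U = begin
    W zero zero * fullRooks (transpose (dropCol W)) K (true ∷ U) + sumFin below
      ≈⟨ +-cong (*-congˡ (fullRooksᵀ-forbiddenRow (dropCol W) K U))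
                (sumFin-cong (λ r → []⇒-cong (not (lookup U r)) (*-congˡ (fullRooksᵀ-freeRow (dropCol W) K (U [ r ]≔ true))))) ⟩
    firstRow + sumFin (λ r → [ not (lookup U r) ]⇒ (W (suc r) zero * (rest K (U [ r ]≔ true) + sumFin (laterColumns r))))
      ≈⟨ +-congˡ (trans (sumFin-cong (λ r → []⇒-distrib (not (lookup U r)) _ _ _)) (sumFin-+ notFirstRow _)) ⟩
    firstRow + (sumFin notFirstRow + sumFin (λ r → [ not (lookup U r) ]⇒ (W (suc r) zero * sumFin (laterColumns r))))
      ≈⟨ +-congˡ (+-congˡ exchange) ⟩
    firstRow + (sumFin notFirstRow + sumFin (λ y → [ lookup K y ]⇒ (W zero (suc y) * sumFin (λ r →
      [ not (lookup U r) ]⇒ (W (suc r) zero * rest (K [ y ]≔ false) (U [ r ]≔ true))))))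
      ≈⟨ +-swapˡ _ _ _ ⟩
    sumFin notFirstRow + (firstRow + sumFin (λ y → [ lookup K y ]⇒ (W zero (suc y) * sumFin (λ r →
      [ not (lookup U r) ]⇒ (W (suc r) zero * rest (K [ y ]≔ false) (U [ r ]≔ true)))))) ∎
    where
    rest : Subset q → Subset p → Carrier
    rest = fullRooks (transpose (dropCol (dropRow W)))
    below : Fin p → Carrier
    below r = [ not (lookup U r) ]⇒ (W (suc r) zero * fullRooks (transpose (dropCol W)) K (false ∷ U [ r ]≔ true))
    firstRow : Carrier
    firstRow = W zero zero * rest K U
    notFirstRow : Fin p → Carrier
    notFirstRow r = [ not (lookup U r) ]⇒ (W (suc r) zero * rest K (U [ r ]≔ true))
    laterColumns : Fin p → Fin q → Carrier
    laterColumns r y = [ lookup K y ]⇒ (W zero (suc y) * rest (K [ y ]≔ false) (U [ r ]≔ true))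
    -- the rook of column 0 (in row r) and the rook of row 0 (in column y) are chosen independently
    exchange : sumFin (λ r → [ not (lookup U r) ]⇒ (W (suc r) zero * sumFin (laterColumns r)))
             ≈ sumFin (λ y → [ lookup K y ]⇒ (W zero (suc y) * sumFin (λ r →
                 [ not (lookup U r) ]⇒ (W (suc r) zero * rest (K [ y ]≔ false) (U [ r ]≔ true)))))
    exchange = begin
      sumFin (λ r → [ not (lookup U r) ]⇒ (W (suc r) zero * sumFin (laterColumns r)))
        ≈⟨ sumFin-cong (λ r → []⇒-sumFin-*ˡ (not (lookup U r)) (W (suc r) zero) (laterColumns r)) ⟩
      sumFin (λ r → sumFin (λ y → [ not (lookup U r) ]⇒ (W (suc r) zero * laterColumns r y)))
        ≈⟨ sumFin-swap (λ r y → [ not (lookup U r) ]⇒ (W (suc r) zero * laterColumns r y)) ⟩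
      sumFin (λ y → sumFin (λ r → [ not (lookup U r) ]⇒ (W (suc r) zero * laterColumns r y)))
        ≈⟨ sumFin-cong (λ y → sumFin-cong (λ r → []⇒-swap (not (lookup U r)) (lookup K y) _ _ _)) ⟩
      sumFin (λ y → sumFin (λ r → [ lookup K y ]⇒ (W zero (suc y) * [ not (lookup U r) ]⇒
        (W (suc r) zero * rest (K [ y ]≔ false) (U [ r ]≔ true)))))
        ≈⟨ sumFin-cong (λ y → sym ([]⇒-sumFin-*ˡ (lookup K y) (W zero (suc y)) (λ r →
             [ not (lookup U r) ]⇒ (W (suc r) zero * rest (K [ y ]≔ false) (U [ r ]≔ true))))) ⟩
      sumFin (λ y → [ lookup K y ]⇒ (W zero (suc y) * sumFin (λ r →
        [ not (lookup U r) ]⇒ (W (suc r) zero * rest (K [ y ]≔ false) (U [ r ]≔ true))))) ∎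

  fullRooksᵀ-noRows : ∀ {q} (W : Matrix zero q) K → fullRooks (transpose W) K [] ≈ [ isEmpty K ]⇒ 1#
  fullRooksᵀ-noRows {zero} W [] = refl
  fullRooksᵀ-noRows {suc q} W (false ∷ K) = fullRooksᵀ-noRows (dropCol W) K
  fullRooksᵀ-noRows {suc q} W (true ∷ K) = refl

  coverings-by-columns : ∀ {p q} (W : Matrix p q) H K → fullRooks (transpose W) K (∁ H) ≈ coverings W H K
  coverings-by-columns {zero} W [] K = fullRooksᵀ-noRows W K
  coverings-by-columns {suc p} W (false ∷ H) K =
    trans (fullRooksᵀ-forbiddenRow W K (∁ H)) (coverings-by-columns (dropRow W) H K)
  coverings-by-columns {suc p} W (true ∷ H) K = trans (fullRooksᵀ-freeRow W K (∁ H))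
    (+-cong (coverings-by-columns (dropRow W) H K)
            (sumFin-cong (λ y → []⇒-cong (lookup K y) (*-congˡ (coverings-by-columns (dropRow W) H (K [ y ]≔ false))))))

  coverings-too-many : ∀ {p q} (W : Matrix p q) H K → ∣ H ∣ < ∣ K ∣ → coverings W H K ≈ 0#
  coverings-too-many {zero} W [] K ∣K∣>0 with ∣ K ∣ in ∣K∣≡1+n
  coverings-too-many {zero} W [] K (ℕ.s≤s _) | suc n rewrite isEmpty-∣∣≡suc K n ∣K∣≡1+n = refl
  coverings-too-many {suc p} W (false ∷ H) K ∣H∣<∣K∣ = coverings-too-many (dropRow W) H K ∣H∣<∣K∣
  coverings-too-many {suc p} W (true ∷ H) K 1+∣H∣<∣K∣ = trans
    (+-cong (coverings-too-many (dropRow W) H K (ℕ.<-trans (ℕ.n<1+n _) 1+∣H∣<∣K∣)) (sumFin-0 _ vanishes))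
    (+-identityʳ 0#)
    where
    vanishes : ∀ y → [ lookup K y ]⇒ (W zero y * coverings (dropRow W) H (K [ y ]≔ false)) ≈ 0#
    vanishes y with lookup K y in y∈K
    ... | true = trans (*-congˡ (coverings-too-many (dropRow W) H (K [ y ]≔ false)
                   (ℕ.≤-pred (≡.subst (suc ∣ H ∣ <_) (≡.sym (∣remove∣ K y y∈K)) 1+∣H∣<∣K∣)))) (zeroʳ _)
    ... | false = refl

  coverings-square : ∀ {p q} (W : Matrix p q) H K → ∣ H ∣ ≡ ∣ K ∣ → fullRooks W H (∁ K) ≈ coverings W H K
  coverings-square {zero} W [] K ∣K∣≡0 rewrite isEmpty-∣∣≡0 K (≡.sym ∣K∣≡0) = refl
  coverings-square {suc p} W (false ∷ H) K ∣H∣≡∣K∣ = coverings-square (dropRow W) H K ∣H∣≡∣K∣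
  coverings-square {suc p} W (true ∷ H) K 1+∣H∣≡∣K∣ = trans (sumFin-cong takeColumn)
    (trans (sym (+-identityˡ _))
           (+-congʳ (sym (coverings-too-many (dropRow W) H K (≡.subst (∣ H ∣ <_) 1+∣H∣≡∣K∣ (ℕ.n<1+n _))))))
    where
    takeColumn : ∀ y → [ not (lookup (∁ K) y) ]⇒ (W zero y * fullRooks (dropRow W) H (∁ K [ y ]≔ true))
                     ≈ [ lookup K y ]⇒ (W zero y * coverings (dropRow W) H (K [ y ]≔ false))
    takeColumn y rewrite lookup-map y not K | ∁-remove K y with lookup K y in y∈K
    ... | true = *-congˡ (coverings-square (dropRow W) H (K [ y ]≔ false)
                   (ℕ.suc-injective (≡.trans 1+∣H∣≡∣K∣ (≡.sym (∣remove∣ K y y∈K)))))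
    ... | false = refl

  -- The permanent of A[H | K] counts the coverings of K by H: if ∣H∣ ≤ ∣K∣ it
  -- places the rows (and then ∣H∣ = ∣K∣), otherwise it places the columns.
  per-coverings : ∀ {m n} (A : Matrix m n) H K → ∣ K ∣ ≤ ∣ H ∣ → per (sub A H K) ≈ coverings A H K
  per-coverings A H K ∣K∣≤∣H∣ with ∣ H ∣ ≤? ∣ K ∣
  ... | yes ∣H∣≤∣K∣ = trans (injectionSum-sub A H K) (coverings-square A H K (ℕ.≤-antisym ∣H∣≤∣K∣ ∣K∣≤∣H∣))
  ... | no _ = trans (injectionSum-sub (transpose A) K H) (coverings-by-columns A H K)

  -- rookPoly W H U: the rook polynomial of the rows H of W with the columns
  -- of U forbidden.
  rookPoly : ∀ {p q} → Matrix p q → Subset p → Subset q → Poly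
  rookPoly {zero} W [] U j = constₚ 1# j
  rookPoly {suc p} W (false ∷ H) U j = rookPoly (dropRow W) H U j
  rookPoly {suc p} W (true ∷ H) U j = rookPoly (dropRow W) H U j
    + shift 1 (λ i → sumFin (λ y → [ not (lookup U y) ]⇒ (W zero y * rookPoly (dropRow W) H (U [ y ]≔ true) i))) j

  rookPoly-fullRooks : ∀ {p q} (W : Matrix p q) U j →
    sumSub p (λ S → [ does (∣ S ∣ ℕ.≟ j) ]⇒ fullRooks W S U) ≈ rookPoly W ⊤ U j
  rookPoly-fullRooks {zero} W U zero = refl
  rookPoly-fullRooks {zero} W U (suc j) = refl
  rookPoly-fullRooks {suc p} W U zero = +-cong (rookPoly-fullRooks (dropRow W) U zero) (sumSub-0 p _ (λ S → refl))
  rookPoly-fullRooks {suc p} {q} W U (suc j) = +-cong (rookPoly-fullRooks (dropRow W) U (suc j)) (begin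
    sumSub p (λ S → [ size S ]⇒ sumFin (λ y → [ free y ]⇒ (W zero y * rest S y)))
      ≈⟨ sumSub-cong p (λ S → trans ([]⇒-sumFin {q} (size S) _)
                                    (sumFin-cong (λ y → nested (size S) (free y) (W zero y) _))) ⟩
    sumSub p (λ S → sumFin (λ y → [ free y ]⇒ (W zero y * [ size S ]⇒ rest S y)))
      ≈⟨ sym (sumFin-sumSub-swap p (λ y S → [ free y ]⇒ (W zero y * [ size S ]⇒ rest S y))) ⟩
    sumFin (λ y → sumSub p (λ S → [ free y ]⇒ (W zero y * [ size S ]⇒ rest S y)))
      ≈⟨ sumFin-cong (λ y → sym ([]⇒-sumSub-*ˡ p (free y) (W zero y) _)) ⟩
    sumFin (λ y → [ free y ]⇒ (W zero y * sumSub p (λ S → [ size S ]⇒ rest S y)))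
      ≈⟨ sumFin-cong (λ y → []⇒-cong (free y) (*-congˡ (rookPoly-fullRooks (dropRow W) (U [ y ]≔ true) j))) ⟩
    sumFin (λ y → [ free y ]⇒ (W zero y * rookPoly (dropRow W) ⊤ (U [ y ]≔ true) j)) ∎)
    where
    size : Subset p → Bool
    size S = does (∣ S ∣ ℕ.≟ j)
    free : Fin q → Bool
    free y = not (lookup U y)
    rest : Subset p → Fin q → Carrier
    rest S y = fullRooks (dropRow W) S (U [ y ]≔ true)
    nested : ∀ a b w x → [ a ]⇒ ([ b ]⇒ (w * x)) ≈ [ b ]⇒ (w * [ a ]⇒ x)
    nested true b w x = refl
    nested false true w x = sym (zeroʳ w)
    nested false false w x = refl

  rook-fullRooks : ∀ {p q} (B : Matrix p q) j → rook B j ≈ sumSub p (λ S → [ does (∣ S ∣ ℕ.≟ j) ]⇒ fullRooks B S ⊥)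
  rook-fullRooks {p} B j = trans (sumL-filter (λ S → ∣ S ∣ ℕ.≟ j) (allSubsets p) _)
    (trans (sumL-allSubsets p _) (sumSub-cong p (λ S → []⇒-cong (does (∣ S ∣ ℕ.≟ j))
      (trans (injectionSum-fullRooks ∣ S ∣ (λ i → B (enum S i))) (fullRooks-rows B S ⊥)))))

  rook-rookPoly : ∀ {p q} (B : Matrix p q) → rook B ≈ₚ rookPoly B ⊤ ⊥
  rook-rookPoly B j = trans (rook-fullRooks B j) (rookPoly-fullRooks B ⊥ j)

  rookPoly-rows : ∀ {p q} (W : Matrix p q) H U → rookPoly (λ i → W (enum H i)) ⊤ U ≈ₚ rookPoly W H U
  rookPoly-rows {zero} W [] U j = refl
  rookPoly-rows {suc p} W (false ∷ H) U j = rookPoly-rows (dropRow W) H U j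
  rookPoly-rows {suc p} W (true ∷ H) U j = +-cong (rookPoly-rows (dropRow W) H U j)
    (shift-cong 1 (λ i → sumFin-cong (λ y → []⇒-cong (not (lookup U y)) (*-congˡ (rookPoly-rows (dropRow W) H (U [ y ]≔ true) i)))) j)

  rookPoly-columns : ∀ {p q} (C : Subset q) (V : Matrix p q) H (U : Subset ∣ C ∣) →
                     rookPoly (λ i c → V i (enum C c)) H U ≈ₚ rookPoly V H (extend C U)
  rookPoly-columns {zero} C V [] U j = refl
  rookPoly-columns {suc p} C V (false ∷ H) U j = rookPoly-columns C (dropRow V) H U j
  rookPoly-columns {suc p} C V (true ∷ H) U j = +-cong (rookPoly-columns C (dropRow V) H U j)
    (shift-cong 1 (λ i → trans
      (sumFin-cong (λ c → []⇒-cong (not (lookup U c)) (*-congˡ (trans (rookPoly-columns C (dropRow V) H (U [ c ]≔ true) i)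
         (≡⇒≈ (cong (λ Z → rookPoly (dropRow V) H Z i) (extend-insert C U c)))))))
      (sumFin-columns C U (λ y → V zero y * rookPoly (dropRow V) H (extend C U [ y ]≔ true) i))) j)

  rook-sub : ∀ {m n} (A : Matrix m n) S C → rook (sub A S C) ≈ₚ rookPoly A S (∁ C)
  rook-sub A S C j = begin
    rook (sub A S C) j                              ≈⟨ rook-rookPoly (sub A S C) j ⟩
    rookPoly (sub A S C) ⊤ ⊥ j                      ≈⟨ rookPoly-columns C (λ i → A (enum S i)) ⊤ ⊥ j ⟩
    rookPoly (λ i → A (enum S i)) ⊤ (extend C ⊥) j  ≈⟨ rookPoly-rows A S (extend C ⊥) j ⟩
    rookPoly A S (extend C ⊥) j                     ≈⟨ ≡⇒≈ (cong (λ Z → rookPoly A S Z j) (extend-⊥ C)) ⟩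
    rookPoly A S (∁ C) j ∎

  -- The expansion of rookPoly W ⊤ U along the rows H: the rooks in the rows
  -- of H occupy a set K of free columns, and the remaining rooks avoid U ∪ K.
  Expands : ∀ {p q} → Matrix p q → Subset p → Set ℓ
  Expands {p} {q} W H = ∀ U j →
    rookPoly W ⊤ U j ≈ sumSub q (λ K → [ disjoint K U ]⇒ (coverings W H K * shift ∣ K ∣ (rookPoly W (∁ H) (U ∪ K)) j))

  expansion-noRows : ∀ {q} (W : Matrix zero q) → Expands W []
  expansion-noRows {q} W U j = sym (begin
    sumSub q (λ K → [ disjoint K U ]⇒ ([ isEmpty K ]⇒ 1# * shift ∣ K ∣ (constₚ 1#) j))
      ≈⟨ sumSub-cong q (λ K → onlyEmpty (disjoint K U) (isEmpty K) _) ⟩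
    sumSub q (λ K → [ isEmpty K ]⇒ ([ disjoint K U ]⇒ (1# * shift ∣ K ∣ (constₚ 1#) j)))
      ≈⟨ sumSub-isEmpty q (λ K → [ disjoint K U ]⇒ (1# * shift ∣ K ∣ (constₚ 1#) j)) ⟩
    [ disjoint ⊥ U ]⇒ (1# * shift ∣ ⊥ {q} ∣ (constₚ 1#) j)
      ≈⟨ ≡⇒≈ (cong₂ (λ b k → [ b ]⇒ (1# * shift k (constₚ 1#) j)) (disjoint-⊥ˡ U) (∣⊥∣≡0 q)) ⟩
    1# * constₚ 1# j
      ≈⟨ *-identityˡ _ ⟩
    constₚ 1# j ∎)
    where
    onlyEmpty : ∀ d e x → [ d ]⇒ ([ e ]⇒ 1# * x) ≈ [ e ]⇒ ([ d ]⇒ (1# * x))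
    onlyEmpty d true x = refl
    onlyEmpty d false x = trans ([]⇒-cong d (zeroˡ x)) ([]⇒-0 d)

  -- A row outside H: its rook, in a free column y, belongs to the second
  -- factor; the columns K taken by H must then avoid y as well.
  module SkipRow {p q} (W : Matrix (suc p) q) (H : Subset p) (ih : Expands (dropRow W) H) (U : Subset q) where
    W' : Matrix p q
    W' = dropRow W

    withRook : Subset q → Poly
    withRook K i = sumFin (λ y → [ not (lookup (U ∪ K) y) ]⇒ (W zero y * rookPoly W' (∁ H) ((U ∪ K) [ y ]≔ true) i))

    rookInFirstRow : ∀ i → sumSub q (λ K → [ disjoint K U ]⇒ (coverings W' H K * shift ∣ K ∣ (withRook K) i))
                         ≈ sumFin (λ y → [ not (lookup U y) ]⇒ (W zero y * rookPoly W' ⊤ (U [ y ]≔ true) i))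
    rookInFirstRow i = begin
      sumSub q (λ K → [ disjoint K U ]⇒ (coverings W' H K * shift ∣ K ∣ (withRook K) i))
        ≈⟨ sumSub-cong q (λ K → trans ([]⇒-cong (disjoint K U) (*-congˡ (shiftInside K)))
                                        ([]⇒-sumFin-*ˡ (disjoint K U) (coverings W' H K) (λ y → term' y K))) ⟩
      sumSub q (λ K → sumFin (λ y → term y K))
        ≈⟨ sym (sumFin-sumSub-swap q term) ⟩
      sumFin (λ y → sumSub q (λ K → term y K))
        ≈⟨ sumFin-cong (λ y → sumSub-cong q (λ K → regroup y K)) ⟩
      sumFin (λ y → sumSub q (λ K → [ not (lookup U y) ]⇒ (W zero y * [ disjoint K (U [ y ]≔ true) ]⇒
        (coverings W' H K * shift ∣ K ∣ (rookPoly W' (∁ H) ((U [ y ]≔ true) ∪ K)) i))))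
        ≈⟨ sumFin-cong (λ y → sym ([]⇒-sumSub-*ˡ q (not (lookup U y)) (W zero y) _)) ⟩
      sumFin (λ y → [ not (lookup U y) ]⇒ (W zero y * sumSub q (λ K → [ disjoint K (U [ y ]≔ true) ]⇒
        (coverings W' H K * shift ∣ K ∣ (rookPoly W' (∁ H) ((U [ y ]≔ true) ∪ K)) i))))
        ≈⟨ sumFin-cong (λ y → []⇒-cong (not (lookup U y)) (*-congˡ (sym (ih (U [ y ]≔ true) i)))) ⟩
      sumFin (λ y → [ not (lookup U y) ]⇒ (W zero y * rookPoly W' ⊤ (U [ y ]≔ true) i)) ∎
      where
      term' : Fin q → Subset q → Carrier
      term' y K = [ not (lookup (U ∪ K) y) ]⇒ (W zero y * shift ∣ K ∣ (rookPoly W' (∁ H) ((U ∪ K) [ y ]≔ true)) i)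
      shiftInside : ∀ K → shift ∣ K ∣ (withRook K) i ≈ sumFin (λ y → term' y K)
      shiftInside K = trans (shift-sumFin ∣ K ∣ (λ y i′ → [ not (lookup (U ∪ K) y) ]⇒
                                            (W zero y * rookPoly W' (∁ H) ((U ∪ K) [ y ]≔ true) i′)) i)
        (sumFin-cong (λ y → shift-[]⇒ ∣ K ∣ (not (lookup (U ∪ K) y)) (W zero y) (rookPoly W' (∁ H) ((U ∪ K) [ y ]≔ true)) i))
      term : Fin q → Subset q → Carrier
      term y K = [ disjoint K U ]⇒ (coverings W' H K * term' y K)
      regroup : ∀ y K → term y K ≈ [ not (lookup U y) ]⇒ (W zero y * [ disjoint K (U [ y ]≔ true) ]⇒
                  (coverings W' H K * shift ∣ K ∣ (rookPoly W' (∁ H) ((U [ y ]≔ true) ∪ K)) i))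
      regroup y K rewrite lookup-zipWith _∨_ y U K | disjoint-insertʳ K U y | insert-∪ˡ U K y =
        brackets (disjoint K U) (lookup U y) (lookup K y) (coverings W' H K) (W zero y) _
        where
        brackets : ∀ d u k Q w X → [ d ]⇒ (Q * [ not (u ∨ k) ]⇒ (w * X)) ≈ [ not u ]⇒ (w * [ not k ∧ d ]⇒ (Q * X))
        brackets d true k Q w X = trans ([]⇒-cong d (zeroʳ Q)) ([]⇒-0 d)
        brackets d false true Q w X = trans (trans ([]⇒-cong d (zeroʳ Q)) ([]⇒-0 d)) (sym (zeroʳ w))
        brackets d false false Q w X = []⇒-swap d true Q w X

    rookTerms : ∀ j → sumSub q (λ K → [ disjoint K U ]⇒ (coverings W' H K * shift ∣ K ∣ (shift 1 (withRook K)) j))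
                    ≈ shift 1 (λ i → sumFin (λ y → [ not (lookup U y) ]⇒ (W zero y * rookPoly W' ⊤ (U [ y ]≔ true) i))) j
    rookTerms j = begin
      sumSub q (λ K → [ disjoint K U ]⇒ (coverings W' H K * shift ∣ K ∣ (shift 1 (withRook K)) j))
        ≈⟨ sumSub-cong q (λ K → []⇒-cong (disjoint K U) (*-congˡ (≡⇒≈ (shift-comm ∣ K ∣ (withRook K) j)))) ⟩
      sumSub q (λ K → [ disjoint K U ]⇒ (coverings W' H K * shift 1 (shift ∣ K ∣ (withRook K)) j))
        ≈⟨ sumSub-cong q (λ K → sym (shift-[]⇒ 1 (disjoint K U) (coverings W' H K) (shift ∣ K ∣ (withRook K)) j)) ⟩
      sumSub q (λ K → shift 1 (λ i → [ disjoint K U ]⇒ (coverings W' H K * shift ∣ K ∣ (withRook K) i)) j)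
        ≈⟨ sym (shift-sumSub 1 q (λ K i → [ disjoint K U ]⇒ (coverings W' H K * shift ∣ K ∣ (withRook K) i)) j) ⟩
      shift 1 (λ i → sumSub q (λ K → [ disjoint K U ]⇒ (coverings W' H K * shift ∣ K ∣ (withRook K) i))) j
        ≈⟨ shift-cong 1 rookInFirstRow j ⟩
      shift 1 (λ i → sumFin (λ y → [ not (lookup U y) ]⇒ (W zero y * rookPoly W' ⊤ (U [ y ]≔ true) i))) j ∎

  expansion-skipRow : ∀ {p q} (W : Matrix (suc p) q) H → Expands (dropRow W) H → Expands W (false ∷ H)
  expansion-skipRow {p} {q} W H ih U j = sym (begin
    sumSub q (λ K → [ disjoint K U ]⇒ (coverings W' H K * shift ∣ K ∣ (rookPoly W' (∁ H) (U ∪ K) +ₚ shift 1 (withRook K)) j))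
      ≈⟨ sumSub-cong q (λ K → trans ([]⇒-cong (disjoint K U) (*-congˡ (shift-+ ∣ K ∣ _ _ j))) ([]⇒-distrib (disjoint K U) _ _ _)) ⟩
    sumSub q (λ K → [ disjoint K U ]⇒ (coverings W' H K * shift ∣ K ∣ (rookPoly W' (∁ H) (U ∪ K)) j)
                  + [ disjoint K U ]⇒ (coverings W' H K * shift ∣ K ∣ (shift 1 (withRook K)) j))
      ≈⟨ sumSub-+ q _ _ ⟩
    sumSub q (λ K → [ disjoint K U ]⇒ (coverings W' H K * shift ∣ K ∣ (rookPoly W' (∁ H) (U ∪ K)) j))
      + sumSub q (λ K → [ disjoint K U ]⇒ (coverings W' H K * shift ∣ K ∣ (shift 1 (withRook K)) j))
      ≈⟨ +-cong (sym (ih U j)) (rookTerms j) ⟩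
    rookPoly W ⊤ U j ∎)
    where open SkipRow W H ih U

  -- A row of H: either it is empty, or its rook sits in a column y ∈ K and
  -- the other rows of H cover K ∖ {y}.  Reindexing K ↦ K ∪ {y} turns the
  -- second case into the rook placements with y forbidden.
  module SplitRow {p q} (W : Matrix (suc p) q) (H : Subset p) (ih : Expands (dropRow W) H) (U : Subset q) (j : ℕ) where
    W' : Matrix p q
    W' = dropRow W

    outside : Subset q → Carrier
    outside K = shift ∣ K ∣ (rookPoly W' (∁ H) (U ∪ K)) j

    firstRowAt : Subset q → Fin q → Carrier
    firstRowAt K y = [ lookup K y ]⇒ (W zero y * coverings W' H (K [ y ]≔ false))

    removed : Fin q → Subset q → Carrier
    removed y K = [ disjoint K U ]⇒ ((W zero y * coverings W' H (K [ y ]≔ false)) * outside K)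

    withY : Fin q → Subset q → Carrier
    withY y K = [ not (lookup U y) ]⇒ (W zero y * [ disjoint K (U [ y ]≔ true) ]⇒
                  (coverings W' H K * shift (suc ∣ K ∣) (rookPoly W' (∁ H) ((U [ y ]≔ true) ∪ K)) j))

    reinsert : ∀ y K → [ not (lookup K y) ]⇒ removed y (K [ y ]≔ true) ≈ withY y K
    reinsert y K rewrite disjoint-insertʳ K U y with lookup K y in y∈K
    ... | true = sym (trans ([]⇒-cong (not (lookup U y)) (zeroʳ _)) ([]⇒-0 (not (lookup U y))))
    ... | false rewrite disjoint-insertˡ K U y | remove-insert K y y∈K | ∣insert∣ K y y∈K
                      | insert-∪ʳ U K y | insert-∪ˡ U K y = regroup (not (lookup U y)) (disjoint K U) (W zero y) (coverings W' H K) _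
      where
      regroup : ∀ a d w c z → [ a ∧ d ]⇒ ((w * c) * z) ≈ [ a ]⇒ (w * [ d ]⇒ (c * z))
      regroup true d w c z = trans ([]⇒-cong d (*-assoc w c z)) (sym ([]⇒-*ˡ d w (c * z)))
      regroup false d w c z = refl

    reindexed : sumSub q (λ K → [ disjoint K U ]⇒ (sumFin (firstRowAt K) * outside K))
              ≈ sumFin (λ y → sumSub q (withY y))
    reindexed = begin
      sumSub q (λ K → [ disjoint K U ]⇒ (sumFin (firstRowAt K) * outside K))
        ≈⟨ sumSub-cong q (λ K → []⇒-sumFin-*ʳ (disjoint K U) (firstRowAt K) (outside K)) ⟩
      sumSub q (λ K → sumFin (λ y → [ disjoint K U ]⇒ (firstRowAt K y * outside K)))
        ≈⟨ sym (sumFin-sumSub-swap q (λ y K → [ disjoint K U ]⇒ (firstRowAt K y * outside K))) ⟩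
      sumFin (λ y → sumSub q (λ K → [ disjoint K U ]⇒ (firstRowAt K y * outside K)))
        ≈⟨ sumFin-cong (λ y → sumSub-cong q (λ K → bracketOut (disjoint K U) (lookup K y) (W zero y) _ (outside K))) ⟩
      sumFin (λ y → sumSub q (λ K → [ lookup K y ]⇒ removed y K))
        ≈⟨ sumFin-cong (λ y → sumSub-member q y (removed y)) ⟩
      sumFin (λ y → sumSub q (λ K → [ not (lookup K y) ]⇒ removed y (K [ y ]≔ true)))
        ≈⟨ sumFin-cong (λ y → sumSub-cong q (reinsert y)) ⟩
      sumFin (λ y → sumSub q (withY y)) ∎
      where
      bracketOut : ∀ d k w c s → [ d ]⇒ ([ k ]⇒ (w * c) * s) ≈ [ k ]⇒ ([ d ]⇒ ((w * c) * s))
      bracketOut true true w c s = refl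
      bracketOut true false w c s = zeroˡ s
      bracketOut false k w c s = sym ([]⇒-0 k)

    rookTerms : sumSub q (λ K → [ disjoint K U ]⇒ (sumFin (firstRowAt K) * outside K))
              ≈ shift 1 (λ i → sumFin (λ y → [ not (lookup U y) ]⇒ (W zero y * rookPoly W' ⊤ (U [ y ]≔ true) i))) j
    rookTerms = begin
      sumSub q (λ K → [ disjoint K U ]⇒ (sumFin (firstRowAt K) * outside K))
        ≈⟨ reindexed ⟩
      sumFin (λ y → sumSub q (withY y))
        ≈⟨ sumFin-cong (λ y → sym ([]⇒-sumSub-*ˡ q (not (lookup U y)) (W zero y) _)) ⟩
      sumFin (λ y → [ not (lookup U y) ]⇒ (W zero y * sumSub q (λ K → [ disjoint K (U [ y ]≔ true) ]⇒
        (coverings W' H K * shift (suc ∣ K ∣) (rookPoly W' (∁ H) ((U [ y ]≔ true) ∪ K)) j))))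
        ≈⟨ sumFin-cong (λ y → []⇒-cong (not (lookup U y)) (*-congˡ (shiftOut y))) ⟩
      sumFin (λ y → [ not (lookup U y) ]⇒ (W zero y * shift 1 (rookPoly W' ⊤ (U [ y ]≔ true)) j))
        ≈⟨ sumFin-cong (λ y → sym (shift-[]⇒ 1 (not (lookup U y)) (W zero y) (rookPoly W' ⊤ (U [ y ]≔ true)) j)) ⟩
      sumFin (λ y → shift 1 (λ i → [ not (lookup U y) ]⇒ (W zero y * rookPoly W' ⊤ (U [ y ]≔ true) i)) j)
        ≈⟨ sym (shift-sumFin 1 (λ y i → [ not (lookup U y) ]⇒ (W zero y * rookPoly W' ⊤ (U [ y ]≔ true) i)) j) ⟩
      shift 1 (λ i → sumFin (λ y → [ not (lookup U y) ]⇒ (W zero y * rookPoly W' ⊤ (U [ y ]≔ true) i))) j ∎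
      where
      shiftOut : ∀ y → sumSub q (λ K → [ disjoint K (U [ y ]≔ true) ]⇒
                         (coverings W' H K * shift (suc ∣ K ∣) (rookPoly W' (∁ H) ((U [ y ]≔ true) ∪ K)) j))
                       ≈ shift 1 (rookPoly W' ⊤ (U [ y ]≔ true)) j
      shiftOut y = begin
        sumSub q (λ K → [ disjoint K U' ]⇒ (coverings W' H K * shift (suc ∣ K ∣) (rest K) j))
          ≈⟨ sumSub-cong q (λ K → []⇒-cong (disjoint K U') (*-congˡ (≡⇒≈ (≡.sym (shift-suc ∣ K ∣ (rest K) j))))) ⟩
        sumSub q (λ K → [ disjoint K U' ]⇒ (coverings W' H K * shift 1 (shift ∣ K ∣ (rest K)) j))
          ≈⟨ sumSub-cong q (λ K → sym (shift-[]⇒ 1 (disjoint K U') (coverings W' H K) _ j)) ⟩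
        sumSub q (λ K → shift 1 (λ i → [ disjoint K U' ]⇒ (coverings W' H K * shift ∣ K ∣ (rest K) i)) j)
          ≈⟨ sym (shift-sumSub 1 q _ j) ⟩
        shift 1 (λ i → sumSub q (λ K → [ disjoint K U' ]⇒ (coverings W' H K * shift ∣ K ∣ (rest K) i))) j
          ≈⟨ shift-cong 1 (λ i → sym (ih U' i)) j ⟩
        shift 1 (rookPoly W' ⊤ U') j ∎
        where
        U' : Subset q
        U' = U [ y ]≔ true
        rest : Subset q → Poly
        rest K = rookPoly W' (∁ H) (U' ∪ K)

  expansion-splitRow : ∀ {p q} (W : Matrix (suc p) q) H → Expands (dropRow W) H → Expands W (true ∷ H)
  expansion-splitRow {p} {q} W H ih U j = sym (begin
    sumSub q (λ K → [ disjoint K U ]⇒ ((coverings W' H K + sumFin (firstRowAt K)) * outside K))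
      ≈⟨ sumSub-cong q (λ K → trans ([]⇒-cong (disjoint K U) (distribʳ (outside K) _ _)) ([]⇒-+ (disjoint K U) _ _)) ⟩
    sumSub q (λ K → [ disjoint K U ]⇒ (coverings W' H K * outside K) + [ disjoint K U ]⇒ (sumFin (firstRowAt K) * outside K))
      ≈⟨ sumSub-+ q _ _ ⟩
    sumSub q (λ K → [ disjoint K U ]⇒ (coverings W' H K * outside K))
      + sumSub q (λ K → [ disjoint K U ]⇒ (sumFin (firstRowAt K) * outside K))
      ≈⟨ +-cong (sym (ih U j)) rookTerms ⟩
    rookPoly W ⊤ U j ∎)
    where open SplitRow W H ih U j

  expansion : ∀ {p q} (W : Matrix p q) H → Expands W H
  expansion {zero} W [] = expansion-noRows W
  expansion {suc p} W (false ∷ H) = expansion-skipRow W H (expansion (dropRow W) H)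
  expansion {suc p} W (true ∷ H) = expansion-splitRow W H (expansion (dropRow W) H)

  sumₚ-filter : ∀ {a p} {X : Set a} {P : X → Set p} (P? : ∀ x → Dec (P x)) (xs : List X) (f : X → Poly) j →
                sumₚ (filter P? xs) f j ≈ sumL xs (λ x → [ does (P? x) ]⇒ f x j)
  sumₚ-filter P? xs f j = trans (sumₚ-coefficient (filter P? xs) f j) (sumL-filter P? xs (λ x → f x j))

  -- A term of the theorem is the corresponding term of the expansion with
  -- U = ∅; for ∣K∣ > ∣H∣ the latter vanishes as K has no covering.
  theorem-term : ∀ {m n} (A : Matrix m n) H K j →
    [ does (∣ K ∣ ≤? ∣ H ∣) ]⇒ (((constₚ (per (sub A H K)) *ₚ X^ ∣ K ∣) *ₚ rook (sub A (∁ H) (∁ K))) j)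
      ≈ [ disjoint K ⊥ ]⇒ (coverings A H K * shift ∣ K ∣ (rookPoly A (∁ H) (⊥ ∪ K)) j)
  theorem-term A H K j rewrite disjoint-⊥ʳ K | ∪-identityˡ K = [ ∣ K ∣ ≤? ∣ H ∣ ]⇒-dec
    (λ ∣K∣≤∣H∣ → trans (monomial-* (per (sub A H K)) ∣ K ∣ (rook (sub A (∁ H) (∁ K))) j)
      (*-cong (per-coverings A H K ∣K∣≤∣H∣)
              (shift-cong ∣ K ∣ (λ i → trans (rook-sub A (∁ H) (∁ K) i)
                                   (≡⇒≈ (cong (λ Z → rookPoly A (∁ H) Z i) (∁-involutive K)))) j)))
    (λ ∣K∣≰∣H∣ → sym (trans (*-congʳ (coverings-too-many A H K (ℕ.≰⇒> ∣K∣≰∣H∣))) (zeroˡ _)))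

lemma7 : ∀ {c ℓ} (R : CommutativeRing c ℓ) → let open Rook R in
    ∀ {m n} (A : Matrix m n) (H : Subset m) →
      rook A ≈ₚ sumₚ (filter (λ K → ∣ K ∣ ≤? ∣ H ∣) (allSubsets n))
                     (λ K → (constₚ (per (sub A H K)) *ₚ X^ ∣ K ∣) *ₚ rook (sub A (∁ H) (∁ K)))
lemma7 R {m} {n} A H j = begin
  rook A j
    ≈⟨ rook-rookPoly A j ⟩
  rookPoly A ⊤ ⊥ j
    ≈⟨ expansion A H ⊥ j ⟩
  sumSub n (λ K → [ disjoint K ⊥ ]⇒ (coverings A H K * shift ∣ K ∣ (rookPoly A (∁ H) (⊥ ∪ K)) j))
    ≈⟨ sym (sumSub-cong n (λ K → theorem-term A H K j)) ⟩
  sumSub n (λ K → [ does (∣ K ∣ ≤? ∣ H ∣) ]⇒ term K j)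
    ≈⟨ sym (sumL-allSubsets n _) ⟩
  sumL (allSubsets n) (λ K → [ does (∣ K ∣ ≤? ∣ H ∣) ]⇒ term K j)
    ≈⟨ sym (sumₚ-filter (λ K → ∣ K ∣ ≤? ∣ H ∣) (allSubsets n) term j) ⟩
  sumₚ (filter (λ K → ∣ K ∣ ≤? ∣ H ∣) (allSubsets n)) term j ∎
  where
  open Rook R
  open Expansion R
  open CommutativeRing R using (_*_; setoid; sym)
  open import Relation.Binary.Reasoning.Setoid setoid
  term : Subset n → Poly
  term K = (constₚ (per (sub A H K)) *ₚ X^ ∣ K ∣) *ₚ rook (sub A (∁ H) (∁ K))
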